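{- Let $q\ge2$, $n\ge1$ and $0\le j\le n$. The function $h\colon\{0,\dots,n\}\to\mathbb{R}$, $h(x)=(n-j+1-x)(n-j+2-x)\cdots(n-x)$ (the empty product $1$ when $j=0$), is positive definite.
   Context: Krawtchouk polynomials: $K_k(x)=\sum_{j=0}^k(-1)^j(q-1)^{k-j}\binom{x}{j}\binom{n-x}{k-j}$. A function $h\colon\{0,\dots,n\}\to\mathbb{R}$ is positive definite if the unique reals $c_0,\dots,c_n$ with $h(i)=\sum_{k=0}^nc_kK_k(i)$ for $i=0,\dots,n$ are all nonnegative. -}

module Defs where

open import Data.Nat as ℕ using (ℕ; zero; suc; _∸_)
open import Data.Nat.Combinatorics using (_C_)
open import Data.Fin using (Fin; toℕ)
open import Data.Integer as ℤ using (ℤ; +_; -[1+_])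
open import Data.Rational as ℚ using (ℚ; 0ℚ)
open import Relation.Binary.PropositionalEquality using (_≡_)
open import Data.Product using (Σ; _×_)

sumℤ : (m : ℕ) → (Fin m → ℤ) → ℤ
sumℤ zero f = + 0
sumℤ (suc m) f = f Data.Fin.zero ℤ.+ sumℤ m (λ i → f (Data.Fin.suc i))

sumℚ : (m : ℕ) → (Fin m → ℚ) → ℚ
sumℚ zero f = 0ℚ
sumℚ (suc m) f = f Data.Fin.zero ℚ.+ sumℚ m (λ i → f (Data.Fin.suc i))

prodℤ : (m : ℕ) → (Fin m → ℤ) → ℤ
prodℤ zero f = + 1
prodℤ (suc m) f = f Data.Fin.zero ℤ.* prodℤ m (λ i → f (Data.Fin.suc i))

toℚ : ℤ → ℚ
toℚ z = z ℚ./ 1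

krawtchouk : (q n k x : ℕ) → ℤ
krawtchouk q n k x =
  sumℤ (suc k) (λ i →
    let j = toℕ i in
    (-[1+ 0 ] ℤ.^ j) ℤ.* ((+ (q ∸ 1)) ℤ.^ (k ∸ j))
      ℤ.* (+ (x C j)) ℤ.* (+ ((n ∸ x) C (k ∸ j))))

Represents : (q n : ℕ) → (Fin (suc n) → ℚ) → (Fin (suc n) → ℚ) → Set
Represents q n h c =
  (i : Fin (suc n)) →
    h i ≡ sumℚ (suc n) (λ k → c k ℚ.* toℚ (krawtchouk q n (toℕ k) (toℕ i)))

PositiveDefinite : (q n : ℕ) → (Fin (suc n) → ℚ) → Set
PositiveDefinite q n h =
  Σ (Fin (suc n) → ℚ) λ c →
    Represents q n h c
    × ((c' : Fin (suc n) → ℚ) → Represents q n h c' → (k : Fin (suc n)) → c' k ≡ c k)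
    × ((k : Fin (suc n)) → 0ℚ ℚ.≤ c k)

hfun : (n j x : ℕ) → ℤ
hfun n j x = prodℤ j (λ i → ((+ n) ℤ.- (+ x)) ℤ.- (+ (toℕ i)))

module Submission where

-- Write q = Q + 1 and y = n − x.  K_k(x) is the coefficient of z^k in
-- (1 − z)^x (1 + Q z)^y, i.e. the convolution of (−1)^i C(x,i) with Q^i C(y,i);
-- we treat it as a function K x y k of two independent variables.  Multiplying
-- a generating function by 1 + e z is a local operation on coefficients, which
-- gives the recurrences of K in x and in y; moreover K x y k = 0 for k > x + y.
--
-- Existence and positivity.  h(x) = j! C(y, j), and for x + y = j + r
--        Σ_k C(r + j − k, r) K_k(x, y) = q^j C(y, j)           (pairing-closedForm)
-- by induction on x and y: summation by parts moves each recurrence of K onto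
-- the coefficients, where it becomes Pascal's rule.  Hence
-- c_k = j! C(n − k, n − j) / q^j ≥ 0 is an expansion of h.
--
-- Uniqueness.  The two recurrences combine to K^{n+1}_{k+1}(x+1) =
-- K^{n+1}_{k+1}(x) − q K^n_k(x), so equal expansions at level n + 1 yield equal
-- expansions at level n of the shifted coefficients; induction on n finishes.

open import Defs
open import Data.Nat as ℕ using (ℕ; zero; suc; _∸_; _≤_; _<_; z≤n; s≤s; _!)
import Data.Nat.Properties as ℕP
open import Data.Nat.Combinatorics
  using (_C_; nCk+nC[k+1]≡[n+1]C[k+1]; k>n⇒nCk≡0; nCn≡1; nC1≡n)
open import Data.Nat.Tactic.RingSolver using () renaming (solve-∀ to solve-∀ℕ)
open import Data.Integer as ℤ using (ℤ; +_; -[1+_]; _+_; _*_; _-_; -_)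
import Data.Integer.Properties as ℤP
open import Data.Integer.Tactic.RingSolver using (solve-∀)
open import Data.Fin as Fin using (Fin; toℕ)
import Data.Fin.Properties as FinP
open import Data.Rational as ℚ using (ℚ; 0ℚ; 1ℚ)
import Data.Rational.Properties as ℚP
import Data.Rational.Unnormalised as ℚᵘ
import Data.Rational.Unnormalised.Properties as ℚᵘP
open import Data.Rational.Solver using (module +-*-Solver)
open import Algebra.Properties.Group ℚP.+-0-group using (∙-cancelˡ; ∙-cancelʳ)
open import Data.Product using (_,_)
open import Relation.Nullary using (yes; no)
open import Relation.Binary.PropositionalEquality

open +-*-Solver using (solve; _:+_; _:*_; _:=_)

-- Σℤ m f = Σ_{i < m} f i for a sequence f : ℕ → ℤ.  It is sumℤ read through
-- toℕ, so the Krawtchouk sums of Defs are literally of this form.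
Σℤ : ℕ → (ℕ → ℤ) → ℤ
Σℤ m f = sumℤ m (λ i → f (toℕ i))

Σℤ-cong : ∀ m {f g : ℕ → ℤ} → (∀ i → i < m → f i ≡ g i) → Σℤ m f ≡ Σℤ m g
Σℤ-cong zero    eq = refl
Σℤ-cong (suc m) eq = cong₂ _+_ (eq 0 (s≤s z≤n)) (Σℤ-cong m (λ i i<m → eq (suc i) (s≤s i<m)))

Σℤ-vanish : ∀ m {f : ℕ → ℤ} → (∀ i → i < m → f i ≡ + 0) → Σℤ m f ≡ + 0
Σℤ-vanish zero    eq = refl
Σℤ-vanish (suc m) eq = cong₂ _+_ (eq 0 (s≤s z≤n)) (Σℤ-vanish m (λ i i<m → eq (suc i) (s≤s i<m)))

Σℤ-distrib-+ : ∀ m (f g : ℕ → ℤ) → Σℤ m (λ i → f i + g i) ≡ Σℤ m f + Σℤ m g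
Σℤ-distrib-+ zero    f g = refl
Σℤ-distrib-+ (suc m) f g =
  trans (cong (_+_ (f 0 + g 0)) (Σℤ-distrib-+ m (λ i → f (suc i)) (λ i → g (suc i)))) (middle-swap (f 0) (g 0) (Σℤ m (λ i → f (suc i))) (Σℤ m (λ i → g (suc i))))
  where
  middle-swap : ∀ (a b c d : ℤ) → (a + b) + (c + d) ≡ (a + c) + (b + d)
  middle-swap = solve-∀

Σℤ-scalar : ∀ m (c : ℤ) (f : ℕ → ℤ) → Σℤ m (λ i → c * f i) ≡ c * Σℤ m f
Σℤ-scalar zero    c f = sym (ℤP.*-zeroʳ c)
Σℤ-scalar (suc m) c f =
  trans (cong (_+_ (c * f 0)) (Σℤ-scalar m c (λ i → f (suc i)))) (sym (ℤP.*-distribˡ-+ c (f 0) _))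

Σℤ-dropLast : ∀ m (f : ℕ → ℤ) → f m ≡ + 0 → Σℤ (suc m) f ≡ Σℤ m f
Σℤ-dropLast zero    f f0≡0 = cong (λ t → t + + 0) f0≡0
Σℤ-dropLast (suc m) f fm≡0 = cong (_+_ (f 0)) (Σℤ-dropLast m (λ i → f (suc i)) fm≡0)

pascal : ∀ n k → suc n C suc k ≡ n C k ℕ.+ n C suc k
pascal n k = sym (nCk+nC[k+1]≡[n+1]C[k+1] n k)

pos-pascal : ∀ n k → + (suc n C suc k) ≡ + (n C k) + + (n C suc k)
pos-pascal n k = trans (cong +_ (pascal n k)) (ℤP.pos-+ (n C k) (n C suc k))

-- Absorption (n + 1) C(n, k) = (k + 1) C(n + 1, k + 1); it is what makes a
-- falling factorial a multiple of a binomial coefficient.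
absorption : ∀ n k → suc n ℕ.* (n C k) ≡ suc k ℕ.* (suc n C suc k)
absorption zero    zero    = refl
absorption zero    (suc k) = sym (ℕP.*-zeroʳ (suc (suc k)))
absorption (suc n) zero    = trans (ℕP.*-identityʳ (suc (suc n))) (sym (trans (ℕP.*-identityˡ _) (nC1≡n (suc (suc n)))))
absorption (suc n) (suc k) = begin
  suc (suc n) ℕ.* (suc n C suc k)                       ≡⟨ cong (suc (suc n) ℕ.*_) (pascal n k) ⟩
  suc (suc n) ℕ.* (a ℕ.+ b)                             ≡⟨ expand n a b ⟩
  (a ℕ.+ b) ℕ.+ (suc n ℕ.* a ℕ.+ suc n ℕ.* b)          ≡⟨ cong₂ (λ u v → (a ℕ.+ b) ℕ.+ (u ℕ.+ v)) (absorption n k) (absorption n (suc k)) ⟩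
  (a ℕ.+ b) ℕ.+ (suc k ℕ.* c ℕ.+ suc (suc k) ℕ.* d)    ≡⟨ cong (λ t → t ℕ.+ (suc k ℕ.* c ℕ.+ suc (suc k) ℕ.* d)) (sym (pascal n k)) ⟩
  c ℕ.+ (suc k ℕ.* c ℕ.+ suc (suc k) ℕ.* d)            ≡⟨ collect k c d ⟩
  suc (suc k) ℕ.* (c ℕ.+ d)                             ≡⟨ cong (suc (suc k) ℕ.*_) (sym (pascal (suc n) (suc k))) ⟩
  suc (suc k) ℕ.* (suc (suc n) C suc (suc k))           ∎
  where
  open ≡-Reasoning
  a = n C k
  b = n C suc k
  c = suc n C suc k
  d = suc n C suc (suc k)
  expand : ∀ n a b → suc (suc n) ℕ.* (a ℕ.+ b) ≡ (a ℕ.+ b) ℕ.+ (suc n ℕ.* a ℕ.+ suc n ℕ.* b)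
  expand = solve-∀ℕ
  collect : ∀ k c d → c ℕ.+ (suc k ℕ.* c ℕ.+ suc (suc k) ℕ.* d) ≡ suc (suc k) ℕ.* (c ℕ.+ d)
  collect = solve-∀ℕ

prodℤ-cong : ∀ m {f g : Fin m → ℤ} → (∀ i → f i ≡ g i) → prodℤ m f ≡ prodℤ m g
prodℤ-cong zero    eq = refl
prodℤ-cong (suc m) eq = cong₂ _*_ (eq Fin.zero) (prodℤ-cong m (λ i → eq (Fin.suc i)))

fallingFactorial : ∀ j y → prodℤ j (λ i → + y - + toℕ i) ≡ + (j ! ℕ.* (y C j))
fallingFactorial zero    y       = refl
fallingFactorial (suc j) zero    = sym (cong +_ (ℕP.*-zeroʳ (suc j !)))
fallingFactorial (suc j) (suc y) = begin
  (+ suc y - + 0) * prodℤ j (λ i → + suc y - + suc (toℕ i))  ≡⟨ cong₂ _*_ (ℤP.+-identityʳ (+ suc y)) (prodℤ-cong j (λ i → lower (toℕ i))) ⟩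
  + suc y * prodℤ j (λ i → + y - + toℕ i)                     ≡⟨ cong (+ suc y *_) (fallingFactorial j y) ⟩
  + suc y * + (j ! ℕ.* (y C j))                               ≡⟨ sym (ℤP.pos-* (suc y) (j ! ℕ.* (y C j))) ⟩
  + (suc y ℕ.* (j ! ℕ.* (y C j)))                             ≡⟨ cong +_ (trans (swap (suc y) (j !) (y C j)) (cong (j ! ℕ.*_) (absorption y j))) ⟩
  + (j ! ℕ.* (suc j ℕ.* (suc y C suc j)))                     ≡⟨ cong +_ (reassoc (j !) (suc j) (suc y C suc j)) ⟩
  + (suc j ! ℕ.* (suc y C suc j))                             ∎
  where
  open ≡-Reasoning
  lower : ∀ i → + suc y - + suc i ≡ + y - + i
  lower i = trans (ℤP.m-n≡m⊖n (suc y) (suc i)) (trans (ℤP.[1+m]⊖[1+n]≡m⊖n y i) (sym (ℤP.m-n≡m⊖n y i)))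
  swap : ∀ a b c → a ℕ.* (b ℕ.* c) ≡ b ℕ.* (a ℕ.* c)
  swap = solve-∀ℕ
  reassoc : ∀ a b c → a ℕ.* (b ℕ.* c) ≡ (b ℕ.* a) ℕ.* c
  reassoc = solve-∀ℕ

hfun-binomial : ∀ n j x → x ≤ n → hfun n j x ≡ + (j ! ℕ.* ((n ∸ x) C j))
hfun-binomial n j x x≤n =
  trans (cong (λ z → prodℤ j (λ i → z - + toℕ i)) (trans (ℤP.m-n≡m⊖n n x) (ℤP.⊖-≥ x≤n)))
        (fallingFactorial j (n ∸ x))

-- f′ is (1 + e z) f as generating functions.
record MulLinear (e : ℤ) (f f′ : ℕ → ℤ) : Set where
  field
    at-zero : f′ 0 ≡ f 0
    at-suc  : ∀ i → f′ (suc i) ≡ f (suc i) + e * f i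
open MulLinear

_⋆_ : (ℕ → ℤ) → (ℕ → ℤ) → ℕ → ℤ
(f ⋆ g) k = Σℤ (suc k) (λ i → f i * g (k ∸ i))

⋆-mulLinearˡ : ∀ {e f f′} → MulLinear e f f′ → ∀ g → MulLinear e (f ⋆ g) (f′ ⋆ g)
⋆-mulLinearˡ {e} {f} {f′} f′≡ g .at-zero = cong (λ t → t * g 0 + + 0) (f′≡ .at-zero)
⋆-mulLinearˡ {e} {f} {f′} f′≡ g .at-suc k = begin
  f′ 0 * g (suc k) + Σℤ (suc k) (λ i → f′ (suc i) * g (k ∸ i))
    ≡⟨ cong₂ (λ u v → u * g (suc k) + v) (f′≡ .at-zero) (Σℤ-cong (suc k) (λ i _ → split i)) ⟩
  f 0 * g (suc k) + Σℤ (suc k) (λ i → f (suc i) * g (k ∸ i) + e * (f i * g (k ∸ i)))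
    ≡⟨ cong (_+_ (f 0 * g (suc k))) (trans (Σℤ-distrib-+ (suc k) (λ i → f (suc i) * g (k ∸ i)) (λ i → e * (f i * g (k ∸ i))))
                                         (cong (_+_ (Σℤ (suc k) (λ i → f (suc i) * g (k ∸ i)))) (Σℤ-scalar (suc k) e (λ i → f i * g (k ∸ i))))) ⟩
  f 0 * g (suc k) + (Σℤ (suc k) (λ i → f (suc i) * g (k ∸ i)) + e * (f ⋆ g) k)
    ≡⟨ sym (ℤP.+-assoc (f 0 * g (suc k)) (Σℤ (suc k) (λ i → f (suc i) * g (k ∸ i))) (e * (f ⋆ g) k)) ⟩
  (f ⋆ g) (suc k) + e * (f ⋆ g) k ∎
  where
  open ≡-Reasoning
  distrib : ∀ (a e b c : ℤ) → (a + e * b) * c ≡ a * c + e * (b * c)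
  distrib = solve-∀
  split : ∀ i → f′ (suc i) * g (k ∸ i) ≡ f (suc i) * g (k ∸ i) + e * (f i * g (k ∸ i))
  split i = trans (cong (_* g (k ∸ i)) (f′≡ .at-suc i)) (distrib (f (suc i)) e (f i) (g (k ∸ i)))

⋆-mulLinearʳ : ∀ {e g g′} → MulLinear e g g′ → ∀ f → MulLinear e (f ⋆ g) (f ⋆ g′)
⋆-mulLinearʳ {e} {g} {g′} g′≡ f .at-zero = cong (λ t → f 0 * t + + 0) (g′≡ .at-zero)
⋆-mulLinearʳ {e} {g} {g′} g′≡ f .at-suc = step f
  where
  first : ∀ (f₀ f₁ g₀ g₁ e : ℤ) → f₀ * (g₁ + e * g₀) + (f₁ * g₀ + + 0) ≡ (f₀ * g₁ + (f₁ * g₀ + + 0)) + e * (f₀ * g₀ + + 0)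
  first = solve-∀
  later : ∀ (f₀ g₂ g₁ e A B : ℤ) → f₀ * (g₂ + e * g₁) + (A + e * B) ≡ (f₀ * g₂ + A) + e * (f₀ * g₁ + B)
  later = solve-∀
  step : ∀ f k → (f ⋆ g′) (suc k) ≡ (f ⋆ g) (suc k) + e * (f ⋆ g) k
  step f zero    = trans (cong₂ (λ u v → f 0 * u + (f 1 * v + + 0)) (g′≡ .at-suc 0) (g′≡ .at-zero)) (first (f 0) (f 1) (g 0) (g 1) e)
  step f (suc k) = trans (cong₂ (λ u v → f 0 * u + v) (g′≡ .at-suc (suc k)) (step (λ i → f (suc i)) k)) (later (f 0) (g (suc (suc k))) (g (suc k)) e (((λ i → f (suc i)) ⋆ g) (suc k)) (((λ i → f (suc i)) ⋆ g) k))

Σℤ-byParts : ∀ N (c : ℕ → ℤ) {e : ℤ} {K K′ : ℕ → ℤ} → MulLinear e K K′ → K (suc N) ≡ + 0 →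
  Σℤ (suc (suc N)) (λ k → c k * K′ k) ≡ Σℤ (suc N) (λ k → (c k + e * c (suc k)) * K k)
Σℤ-byParts N c {e} {K} {K′} K′≡ K-end = begin
  c 0 * K′ 0 + Σℤ (suc N) (λ k → c (suc k) * K′ (suc k))
    ≡⟨ cong₂ (λ u v → c 0 * u + v) (K′≡ .at-zero) (Σℤ-cong (suc N) (λ k _ → split k)) ⟩
  c 0 * K 0 + Σℤ (suc N) (λ k → c (suc k) * K (suc k) + e * (c (suc k) * K k))
    ≡⟨ cong (_+_ (c 0 * K 0)) (trans (Σℤ-distrib-+ (suc N) (λ k → c (suc k) * K (suc k)) (λ k → e * (c (suc k) * K k))) (cong (λ t → t + Σℤ (suc N) (λ k → e * (c (suc k) * K k))) drop)) ⟩
  c 0 * K 0 + (Σℤ N (λ k → c (suc k) * K (suc k)) + Σℤ (suc N) (λ k → e * (c (suc k) * K k)))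
    ≡⟨ sym (ℤP.+-assoc (c 0 * K 0) (Σℤ N (λ k → c (suc k) * K (suc k))) (Σℤ (suc N) (λ k → e * (c (suc k) * K k)))) ⟩
  Σℤ (suc N) (λ k → c k * K k) + Σℤ (suc N) (λ k → e * (c (suc k) * K k))
    ≡⟨ sym (Σℤ-distrib-+ (suc N) (λ k → c k * K k) (λ k → e * (c (suc k) * K k))) ⟩
  Σℤ (suc N) (λ k → c k * K k + e * (c (suc k) * K k))
    ≡⟨ Σℤ-cong (suc N) (λ k _ → collect (c k) e (c (suc k)) (K k)) ⟩
  Σℤ (suc N) (λ k → (c k + e * c (suc k)) * K k) ∎
  where
  open ≡-Reasoning
  distrib : ∀ (c a e b : ℤ) → c * (a + e * b) ≡ c * a + e * (c * b)
  distrib = solve-∀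
  collect : ∀ (a e b k : ℤ) → a * k + e * (b * k) ≡ (a + e * b) * k
  collect = solve-∀
  split : ∀ k → c (suc k) * K′ (suc k) ≡ c (suc k) * K (suc k) + e * (c (suc k) * K k)
  split k = trans (cong (c (suc k) *_) (K′≡ .at-suc k)) (distrib (c (suc k)) (K (suc k)) e (K k))
  drop : Σℤ (suc N) (λ k → c (suc k) * K (suc k)) ≡ Σℤ N (λ k → c (suc k) * K (suc k))
  drop = Σℤ-dropLast N (λ k → c (suc k) * K (suc k)) (trans (cong (c (suc N) *_) K-end) (ℤP.*-zeroʳ (c (suc N))))

-- coeff r j k = C(r + j − k, r) for k ≤ j and 0 for k > j; for n = j + r and
-- k ≤ n this is C(n − k, n − j), the coefficient sequence of the theorem.
coeff : ℕ → ℕ → ℕ → ℕ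
coeff r j       zero    = (r ℕ.+ j) C r
coeff r zero    (suc k) = 0
coeff r (suc j) (suc k) = coeff r j k

coeff-origin : ∀ r → coeff r 0 0 ≡ 1
coeff-origin r = trans (cong (_C r) (ℕP.+-identityʳ r)) (nCn≡1 r)

coeff-pascalʳ : ∀ r j k → coeff (suc r) j k ≡ coeff (suc r) j (suc k) ℕ.+ coeff r j k
coeff-pascalʳ r zero    zero    = trans (coeff-origin (suc r)) (sym (coeff-origin r))
coeff-pascalʳ r (suc j) zero    =
  trans (pascal (r ℕ.+ suc j) r) (trans (ℕP.+-comm ((r ℕ.+ suc j) C r) ((r ℕ.+ suc j) C suc r)) (cong (λ t → t C suc r ℕ.+ (r ℕ.+ suc j) C r) (ℕP.+-suc r j)))
coeff-pascalʳ r zero    (suc k) = refl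
coeff-pascalʳ r (suc j) (suc k) = coeff-pascalʳ r j k

coeff-pascalʲ : ∀ r j k → coeff (suc r) (suc j) k ≡ coeff r (suc j) k ℕ.+ coeff (suc r) j k
coeff-pascalʲ r j zero    = trans (pascal (r ℕ.+ suc j) r) (cong (λ t → (r ℕ.+ suc j) C r ℕ.+ t C suc r) (ℕP.+-suc r j))
coeff-pascalʲ r j (suc k) = trans (coeff-pascalʳ r j k) (ℕP.+-comm (coeff (suc r) j (suc k)) (coeff r j k))

coeff-indicator : ∀ j k → k ≤ j → coeff 0 j k ≡ 1
coeff-indicator j       zero    _         = refl
coeff-indicator (suc j) (suc k) (s≤s k≤j) = coeff-indicator j k k≤j

module Krawtchouk (Q : ℕ) where

  alt : ℕ → ℕ → ℤ
  alt x i = (-[1+ 0 ] ℤ.^ i) * + (x C i)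

  geo : ℕ → ℕ → ℤ
  geo y i = ((+ Q) ℤ.^ i) * + (y C i)

  -- K x y k: the Krawtchouk value K_k(x) for q = Q + 1, with y = n − x free
  K : ℕ → ℕ → ℕ → ℤ
  K x y = alt x ⋆ geo y

  krawtchouk≡K : ∀ n k x → krawtchouk (suc Q) n k x ≡ K x (n ∸ x) k
  krawtchouk≡K n k x = Σℤ-cong (suc k) (λ i _ → reassoc (-[1+ 0 ] ℤ.^ i) ((+ Q) ℤ.^ (k ∸ i)) (+ (x C i)) (+ ((n ∸ x) C (k ∸ i))))
    where
    reassoc : ∀ (s t u v : ℤ) → ((s * t) * u) * v ≡ (s * u) * (t * v)
    reassoc = solve-∀

  alt-suc : ∀ x → MulLinear -[1+ 0 ] (alt x) (alt (suc x))
  alt-suc x .at-zero = refl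
  alt-suc x .at-suc i = trans (cong (-[1+ 0 ] ℤ.^ suc i *_) (pos-pascal x i)) (distrib (-[1+ 0 ] ℤ.^ i) (+ (x C i)) (+ (x C suc i)))
    where
    distrib : ∀ (s u v : ℤ) → (- (+ 1) * s) * (u + v) ≡ (- (+ 1) * s) * v + - (+ 1) * (s * u)
    distrib = solve-∀

  geo-suc : ∀ y → MulLinear (+ Q) (geo y) (geo (suc y))
  geo-suc y .at-zero = refl
  geo-suc y .at-suc i = trans (cong ((+ Q) ℤ.^ suc i *_) (pos-pascal y i)) (distrib ((+ Q) ℤ.^ i) (+ (y C i)) (+ (y C suc i)) (+ Q))
    where
    distrib : ∀ (s u v q : ℤ) → (q * s) * (u + v) ≡ (q * s) * v + q * (s * u)
    distrib = solve-∀

  K-sucˣ : ∀ x y → MulLinear -[1+ 0 ] (K x y) (K (suc x) y)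
  K-sucˣ x y = ⋆-mulLinearˡ (alt-suc x) (geo y)

  K-sucʸ : ∀ x y → MulLinear (+ Q) (K x y) (K x (suc y))
  K-sucʸ x y = ⋆-mulLinearʳ (geo-suc y) (alt x)

  -- (1 − z)^x (1 + Q z)^y has degree x + y
  K-vanish : ∀ x y k → x ℕ.+ y < k → K x y k ≡ + 0
  K-vanish x y k x+y<k = Σℤ-vanish (suc k) term
    where
    y<k∸i : ∀ i k → i ℕ.+ y < k → y < k ∸ i
    y<k∸i zero    k       lt        = lt
    y<k∸i (suc i) (suc k) (s≤s lt) = y<k∸i i k lt
    term : ∀ i → i < suc k → alt x i * geo y (k ∸ i) ≡ + 0
    term i _ with i ℕ.≤? x
    ... | yes i≤x rewrite k>n⇒nCk≡0 (y<k∸i i k (ℕP.≤-<-trans (ℕP.+-monoˡ-≤ y i≤x) x+y<k))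
                        | ℤP.*-zeroʳ ((+ Q) ℤ.^ (k ∸ i)) = ℤP.*-zeroʳ (alt x i)
    ... | no i≰x  rewrite k>n⇒nCk≡0 (ℕP.≰⇒> i≰x) | ℤP.*-zeroʳ (-[1+ 0 ] ℤ.^ i) = refl

  krawtchouk-step : ∀ n k x → x ≤ n →
    krawtchouk (suc Q) (suc n) (suc k) (suc x) ≡ krawtchouk (suc Q) (suc n) (suc k) x + -[1+ Q ] * krawtchouk (suc Q) n k x
  krawtchouk-step n k x x≤n = begin
    krawtchouk (suc Q) (suc n) (suc k) (suc x)     ≡⟨ krawtchouk≡K (suc n) (suc k) (suc x) ⟩
    K (suc x) y (suc k)                            ≡⟨ K-sucˣ x y .at-suc k ⟩
    K x y (suc k) + - (+ 1) * K x y k              ≡⟨ regroup (K x y (suc k)) (K x y k) (+ Q) ⟩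
    (K x y (suc k) + + Q * K x y k) + -[1+ Q ] * K x y k
      ≡⟨ cong (λ t → t + -[1+ Q ] * K x y k) (sym (K-sucʸ x y .at-suc k)) ⟩
    K x (suc y) (suc k) + -[1+ Q ] * K x y k
      ≡⟨ cong₂ (λ u v → u + -[1+ Q ] * v)
           (sym (trans (krawtchouk≡K (suc n) (suc k) x) (cong (λ t → K x t (suc k)) (ℕP.+-∸-assoc 1 x≤n))))
           (sym (krawtchouk≡K n k x)) ⟩
    krawtchouk (suc Q) (suc n) (suc k) x + -[1+ Q ] * krawtchouk (suc Q) n k x ∎
    where
    open ≡-Reasoning
    y = n ∸ x
    regroup : ∀ (a b q : ℤ) → a + - (+ 1) * b ≡ (a + q * b) + - (+ 1 + q) * b
    regroup = solve-∀

  q : ℤ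
  q = + suc Q

  -- Σ_k coeff r j k · K_k(x, y), summed over the support k ≤ x + y of K x y.
  pairing : (r j x y : ℕ) → ℤ
  pairing r j x y = Σℤ (suc (x ℕ.+ y)) (λ k → + coeff r j k * K x y k)

  -- The recurrence in x turns into Pascal's rule in r …
  pairing-sucˣ : ∀ r j x y → pairing (suc r) j (suc x) y ≡ pairing r j x y
  pairing-sucˣ r j x y =
    trans (Σℤ-byParts (x ℕ.+ y) (λ k → + coeff (suc r) j k) (K-sucˣ x y) (K-vanish x y _ (ℕP.n<1+n _)))
          (Σℤ-cong (suc (x ℕ.+ y)) (λ k _ → term k))
    where
    cancel : ∀ (a b t : ℤ) → ((a + b) + - (+ 1) * a) * t ≡ b * t
    cancel = solve-∀
    term : ∀ k → (+ coeff (suc r) j k + -[1+ 0 ] * + coeff (suc r) j (suc k)) * K x y k ≡ + coeff r j k * K x y k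
    term k = trans (cong (λ t → (t + -[1+ 0 ] * + coeff (suc r) j (suc k)) * K x y k)
                         (trans (cong +_ (coeff-pascalʳ r j k)) (ℤP.pos-+ (coeff (suc r) j (suc k)) (coeff r j k))))
                   (cancel (+ coeff (suc r) j (suc k)) (+ coeff r j k) (K x y k))

  -- … except at r = 0, where the coefficients are constant and cancel out.
  pairing-sucˣ-edge : ∀ j x y → x ℕ.+ y ≡ j → pairing 0 (suc j) (suc x) y ≡ + 0
  pairing-sucˣ-edge j x y x+y≡j =
    trans (Σℤ-byParts (x ℕ.+ y) (λ k → + coeff 0 (suc j) k) (K-sucˣ x y) (K-vanish x y _ (ℕP.n<1+n _)))
          (Σℤ-vanish (suc (x ℕ.+ y)) term)
    where
    term : ∀ k → k < suc (x ℕ.+ y) → (+ coeff 0 (suc j) k + -[1+ 0 ] * + coeff 0 j k) * K x y k ≡ + 0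
    term k (s≤s k≤x+y) with k≤j ← subst (k ≤_) x+y≡j k≤x+y
      rewrite coeff-indicator (suc j) k (ℕP.m≤n⇒m≤1+n k≤j) | coeff-indicator j k k≤j = refl

  -- The recurrence in y turns into Pascal's rule in j …
  pairing-sucʸ : ∀ r j x y → pairing (suc r) (suc j) x (suc y) ≡ pairing r (suc j) x y + q * pairing (suc r) j x y
  pairing-sucʸ r j x y = begin
    pairing (suc r) (suc j) x (suc y)
      ≡⟨ cong (λ t → Σℤ (suc t) (λ k → + coeff (suc r) (suc j) k * K x (suc y) k)) (ℕP.+-suc x y) ⟩
    Σℤ (suc (suc (x ℕ.+ y))) (λ k → + coeff (suc r) (suc j) k * K x (suc y) k)
      ≡⟨ Σℤ-byParts (x ℕ.+ y) (λ k → + coeff (suc r) (suc j) k) (K-sucʸ x y) (K-vanish x y _ (ℕP.n<1+n _)) ⟩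
    Σℤ (suc (x ℕ.+ y)) (λ k → (+ coeff (suc r) (suc j) k + + Q * + coeff (suc r) j k) * K x y k)
      ≡⟨ Σℤ-cong (suc (x ℕ.+ y)) (λ k _ → term k) ⟩
    Σℤ (suc (x ℕ.+ y)) (λ k → + coeff r (suc j) k * K x y k + q * (+ coeff (suc r) j k * K x y k))
      ≡⟨ trans (Σℤ-distrib-+ (suc (x ℕ.+ y)) (λ k → + coeff r (suc j) k * K x y k) (λ k → q * (+ coeff (suc r) j k * K x y k)))
               (cong (_+_ (pairing r (suc j) x y)) (Σℤ-scalar (suc (x ℕ.+ y)) q (λ k → + coeff (suc r) j k * K x y k))) ⟩
    pairing r (suc j) x y + q * pairing (suc r) j x y ∎
    where
    open ≡-Reasoning
    regroup : ∀ (a b Q t : ℤ) → ((a + b) + Q * b) * t ≡ a * t + (+ 1 + Q) * (b * t)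
    regroup = solve-∀
    term : ∀ k → (+ coeff (suc r) (suc j) k + + Q * + coeff (suc r) j k) * K x y k
               ≡ + coeff r (suc j) k * K x y k + q * (+ coeff (suc r) j k * K x y k)
    term k = trans (cong (λ t → (t + + Q * + coeff (suc r) j k) * K x y k)
                         (trans (cong +_ (coeff-pascalʲ r j k)) (ℤP.pos-+ (coeff r (suc j) k) (coeff (suc r) j k))))
                   (regroup (+ coeff r (suc j) k) (+ coeff (suc r) j k) (+ Q) (K x y k))

  -- … and at r = 0 into multiplication by q.
  pairing-sucʸ-edge : ∀ j x y → x ℕ.+ y ≡ j → pairing 0 (suc j) x (suc y) ≡ q * pairing 0 j x y
  pairing-sucʸ-edge j x y x+y≡j = begin
    pairing 0 (suc j) x (suc y)
      ≡⟨ cong (λ t → Σℤ (suc t) (λ k → + coeff 0 (suc j) k * K x (suc y) k)) (ℕP.+-suc x y) ⟩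
    Σℤ (suc (suc (x ℕ.+ y))) (λ k → + coeff 0 (suc j) k * K x (suc y) k)
      ≡⟨ Σℤ-byParts (x ℕ.+ y) (λ k → + coeff 0 (suc j) k) (K-sucʸ x y) (K-vanish x y _ (ℕP.n<1+n _)) ⟩
    Σℤ (suc (x ℕ.+ y)) (λ k → (+ coeff 0 (suc j) k + + Q * + coeff 0 j k) * K x y k)
      ≡⟨ Σℤ-cong (suc (x ℕ.+ y)) term ⟩
    Σℤ (suc (x ℕ.+ y)) (λ k → q * (+ coeff 0 j k * K x y k))
      ≡⟨ Σℤ-scalar (suc (x ℕ.+ y)) q (λ k → + coeff 0 j k * K x y k) ⟩
    q * pairing 0 j x y ∎
    where
    open ≡-Reasoning
    regroup : ∀ (Q t : ℤ) → (+ 1 + Q * + 1) * t ≡ (+ 1 + Q) * (+ 1 * t)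
    regroup = solve-∀
    term : ∀ k → k < suc (x ℕ.+ y) → (+ coeff 0 (suc j) k + + Q * + coeff 0 j k) * K x y k ≡ q * (+ coeff 0 j k * K x y k)
    term k (s≤s k≤x+y) with k≤j ← subst (k ≤_) x+y≡j k≤x+y
      rewrite coeff-indicator (suc j) k (ℕP.m≤n⇒m≤1+n k≤j) | coeff-indicator j k k≤j = regroup (+ Q) (K x y k)

  -- For j = 0 only k = 0 contributes, with coefficient 1 and K_0 = 1.
  pairing-j≡0 : ∀ r x y → pairing r 0 x y ≡ + 1
  pairing-j≡0 r x y = cong₂ _+_ (cong (λ t → + t * + 1) (coeff-origin r)) (Σℤ-vanish (x ℕ.+ y) (λ _ _ → refl))

  pairing-closedForm : ∀ x y j r → x ℕ.+ y ≡ j ℕ.+ r → pairing r j x y ≡ q ℤ.^ j * + (y C j)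
  pairing-closedForm x y zero r _ = pairing-j≡0 r x y
  pairing-closedForm zero zero (suc j) r ()
  pairing-closedForm (suc x) y (suc j) (suc r) eq =
    trans (pairing-sucˣ r (suc j) x y) (pairing-closedForm x y (suc j) r (trans (ℕP.suc-injective eq) (ℕP.+-suc j r)))
  pairing-closedForm (suc x) y (suc j) zero eq =
    trans (pairing-sucˣ-edge j x y x+y≡j)
          (sym (trans (cong (λ u → q ℤ.^ suc j * + u) (k>n⇒nCk≡0 (s≤s (subst (y ≤_) x+y≡j (ℕP.m≤n+m y x)))))
                      (ℤP.*-zeroʳ (q ℤ.^ suc j))))
    where
    x+y≡j : x ℕ.+ y ≡ j
    x+y≡j = trans (ℕP.suc-injective eq) (ℕP.+-identityʳ j)
  pairing-closedForm zero (suc y) (suc j) (suc r) eq = begin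
    pairing (suc r) (suc j) 0 (suc y)                           ≡⟨ pairing-sucʸ r j 0 y ⟩
    pairing r (suc j) 0 y + q * pairing (suc r) j 0 y
      ≡⟨ cong₂ (λ u v → u + q * v) (pairing-closedForm 0 y (suc j) r (trans y≡ (ℕP.+-suc j r)))
                                   (pairing-closedForm 0 y j (suc r) y≡) ⟩
    q ℤ.^ suc j * + (y C suc j) + q * (q ℤ.^ j * + (y C j))   ≡⟨ regroup q (q ℤ.^ j) _ _ ⟩
    q ℤ.^ suc j * (+ (y C j) + + (y C suc j))                  ≡⟨ cong (q ℤ.^ suc j *_) (sym (pos-pascal y j)) ⟩
    q ℤ.^ suc j * + (suc y C suc j)                            ∎
    where
    open ≡-Reasoning
    y≡ : y ≡ j ℕ.+ suc r
    y≡ = ℕP.suc-injective eq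
    regroup : ∀ (q t a b : ℤ) → (q * t) * b + q * (t * a) ≡ (q * t) * (a + b)
    regroup = solve-∀
  pairing-closedForm zero (suc y) (suc j) zero eq = begin
    pairing 0 (suc j) 0 (suc y)                ≡⟨ pairing-sucʸ-edge j 0 y y≡j ⟩
    q * pairing 0 j 0 y                        ≡⟨ cong (q *_) (pairing-closedForm 0 y j 0 (trans y≡j (sym (ℕP.+-identityʳ j)))) ⟩
    q * (q ℤ.^ j * + (y C j))                  ≡⟨ cong (λ u → q * (q ℤ.^ j * + u)) (trans (cong (_C j) y≡j) (nCn≡1 j)) ⟩
    q * (q ℤ.^ j * + 1)                        ≡⟨ sym (ℤP.*-assoc q (q ℤ.^ j) (+ 1)) ⟩
    q ℤ.^ suc j * + 1                          ≡⟨ cong (λ u → q ℤ.^ suc j * + u) (sym (trans (cong (λ t → suc t C suc j) y≡j) (nCn≡1 (suc j)))) ⟩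
    q ℤ.^ suc j * + (suc y C suc j)            ∎
    where
    open ≡-Reasoning
    y≡j : y ≡ j
    y≡j = trans (ℕP.suc-injective eq) (ℕP.+-identityʳ j)

  integralExpansion : ∀ n j r x → j ℕ.+ r ≡ n → x ≤ n →
    q ℤ.^ j * hfun n j x ≡ Σℤ (suc n) (λ k → + (j ! ℕ.* coeff r j k) * krawtchouk (suc Q) n k x)
  integralExpansion n j r x j+r≡n x≤n = begin
    q ℤ.^ j * hfun n j x                               ≡⟨ cong (q ℤ.^ j *_) (trans (hfun-binomial n j x x≤n) (ℤP.pos-* (j !) _)) ⟩
    q ℤ.^ j * (+ (j !) * + (y C j))                    ≡⟨ swap (q ℤ.^ j) (+ (j !)) _ ⟩
    + (j !) * (q ℤ.^ j * + (y C j))                    ≡⟨ cong (+ (j !) *_) (sym (pairing-closedForm x y j r (trans x+y≡n (sym j+r≡n)))) ⟩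
    + (j !) * pairing r j x y                          ≡⟨ sym (Σℤ-scalar (suc (x ℕ.+ y)) (+ (j !)) (λ k → + coeff r j k * K x y k)) ⟩
    Σℤ (suc (x ℕ.+ y)) (λ k → + (j !) * (+ coeff r j k * K x y k))
      ≡⟨ cong (λ t → Σℤ (suc t) (λ k → + (j !) * (+ coeff r j k * K x y k))) x+y≡n ⟩
    Σℤ (suc n) (λ k → + (j !) * (+ coeff r j k * K x y k))
      ≡⟨ Σℤ-cong (suc n) (λ k _ → term k) ⟩
    Σℤ (suc n) (λ k → + (j ! ℕ.* coeff r j k) * krawtchouk (suc Q) n k x) ∎
    where
    open ≡-Reasoning
    y = n ∸ x
    x+y≡n : x ℕ.+ y ≡ n
    x+y≡n = ℕP.m+[n∸m]≡n x≤n
    swap : ∀ (a b c : ℤ) → a * (b * c) ≡ b * (a * c)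
    swap = solve-∀
    term : ∀ k → + (j !) * (+ coeff r j k * K x y k) ≡ + (j ! ℕ.* coeff r j k) * krawtchouk (suc Q) n k x
    term k = trans (sym (ℤP.*-assoc (+ (j !)) (+ coeff r j k) (K x y k)))
                   (cong₂ _*_ (sym (ℤP.pos-* (j !) (coeff r j k))) (sym (krawtchouk≡K n k x)))

-- The embedding ℤ → ℚ is a ring homomorphism; we check it through ℚᵘ, where
-- toℚ z is z / 1 up to ≃.
toℚ≃ : ∀ z → ℚ.toℚᵘ (toℚ z) ℚᵘ.≃ ℚᵘ.mkℚᵘ z 0
toℚ≃ z = ℚP.toℚᵘ-fromℚᵘ (ℚᵘ.mkℚᵘ z 0)

toℚ-+ : ∀ a b → toℚ (a + b) ≡ toℚ a ℚ.+ toℚ b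
toℚ-+ a b = ℚP.toℚᵘ-injective (ℚᵘP.≃-trans (toℚ≃ (a + b)) (ℚᵘP.≃-sym
  (ℚᵘP.≃-trans (ℚP.toℚᵘ-homo-+ (toℚ a) (toℚ b))
   (ℚᵘP.≃-trans (ℚᵘP.+-cong (toℚ≃ a) (toℚ≃ b)) (ℚᵘ.*≡* (over-one a b))))))
  where
  over-one : ∀ (a b : ℤ) → (a * + 1 + b * + 1) * + 1 ≡ (a + b) * + 1
  over-one = solve-∀

toℚ-* : ∀ a b → toℚ (a * b) ≡ toℚ a ℚ.* toℚ b
toℚ-* a b = ℚP.toℚᵘ-injective (ℚᵘP.≃-trans (toℚ≃ (a * b)) (ℚᵘP.≃-sym
  (ℚᵘP.≃-trans (ℚP.toℚᵘ-homo-* (toℚ a) (toℚ b))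
   (ℚᵘP.≃-trans (ℚᵘP.*-cong (toℚ≃ a) (toℚ≃ b)) (ℚᵘ.*≡* refl)))))

pos-^ : ∀ m j → (+ m) ℤ.^ j ≡ + (m ℕ.^ j)
pos-^ m zero    = refl
pos-^ m (suc j) = trans (cong (+ m *_) (pos-^ m j)) (sym (ℤP.pos-* m (m ℕ.^ j)))

1/p-cancels : ∀ p .{{_ : ℚ.NonZero p}} a → ℚ.1/ p ℚ.* (p ℚ.* a) ≡ a
1/p-cancels p a = trans (sym (ℚP.*-assoc (ℚ.1/ p) p a)) (trans (cong (ℚ._* a) (ℚP.*-inverseˡ p)) (ℚP.*-identityˡ a))

*-cancelʳ-nonZero : ∀ a b c .{{_ : ℚ.NonZero c}} → a ℚ.* c ≡ b ℚ.* c → a ≡ b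
*-cancelʳ-nonZero a b c ac≡bc = begin
  a                         ≡⟨ sym (1/p-cancels c a) ⟩
  ℚ.1/ c ℚ.* (c ℚ.* a)      ≡⟨ cong (ℚ.1/ c ℚ.*_) (trans (ℚP.*-comm c a) (trans ac≡bc (ℚP.*-comm b c))) ⟩
  ℚ.1/ c ℚ.* (c ℚ.* b)      ≡⟨ 1/p-cancels c b ⟩
  b                         ∎
  where open ≡-Reasoning

sumℚ-cong : ∀ m {f g : Fin m → ℚ} → (∀ i → f i ≡ g i) → sumℚ m f ≡ sumℚ m g
sumℚ-cong zero    eq = refl
sumℚ-cong (suc m) eq = cong₂ ℚ._+_ (eq Fin.zero) (sumℚ-cong m (λ i → eq (Fin.suc i)))

sumℚ-distrib-+ : ∀ m (f g : Fin m → ℚ) → sumℚ m (λ i → f i ℚ.+ g i) ≡ sumℚ m f ℚ.+ sumℚ m g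
sumℚ-distrib-+ zero    f g = sym (ℚP.+-identityˡ 0ℚ)
sumℚ-distrib-+ (suc m) f g =
  trans (cong (ℚ._+_ (f Fin.zero ℚ.+ g Fin.zero)) (sumℚ-distrib-+ m (λ i → f (Fin.suc i)) (λ i → g (Fin.suc i))))
        (solve 4 (λ a b A B → (a :+ b) :+ (A :+ B) := (a :+ A) :+ (b :+ B)) refl (f Fin.zero) (g Fin.zero) (sumℚ m (λ i → f (Fin.suc i))) (sumℚ m (λ i → g (Fin.suc i))))

sumℚ-scalar : ∀ m (c : ℚ) (f : Fin m → ℚ) → sumℚ m (λ i → c ℚ.* f i) ≡ c ℚ.* sumℚ m f
sumℚ-scalar zero    c f = sym (ℚP.*-zeroʳ c)
sumℚ-scalar (suc m) c f =
  trans (cong (ℚ._+_ (c ℚ.* f Fin.zero)) (sumℚ-scalar m c (λ i → f (Fin.suc i)))) (sym (ℚP.*-distribˡ-+ c (f Fin.zero) _))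

sumℚ-toℚ : ∀ m (f : Fin m → ℤ) → sumℚ m (λ i → toℚ (f i)) ≡ toℚ (sumℤ m f)
sumℚ-toℚ zero    f = refl
sumℚ-toℚ (suc m) f =
  trans (cong (ℚ._+_ (toℚ (f Fin.zero))) (sumℚ-toℚ m (λ i → f (Fin.suc i)))) (sym (toℚ-+ (f Fin.zero) _))

module Expansions (Q : ℕ) where
  open Krawtchouk Q using (krawtchouk-step)

  T : ℕ → ℕ → ℕ → ℚ
  T n k x = toℚ (krawtchouk (suc Q) n k x)

  expansion : (n : ℕ) → (Fin (suc n) → ℚ) → ℕ → ℚ
  expansion n d x = sumℚ (suc n) (λ k → d k ℚ.* T n (toℕ k) x)

  -- −q = −(Q + 1), the nonzero factor in the level-lowering recurrence
  -q : ℚ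
  -q = toℚ -[1+ Q ]

  instance
    -q≢0 : ℚ.NonZero -q
    -q≢0 = ℚP.neg⇒nonZero -q {{ℚP.neg-pos {ℚ.normalize (suc Q) 1} (ℚP.normalize-pos (suc Q) 1)}}

  -- coefficients of the difference of an expansion, one level down
  shift : ∀ {n} → (Fin (suc (suc n)) → ℚ) → Fin (suc n) → ℚ
  shift d k = d (Fin.suc k) ℚ.* -q

  T-step : ∀ n k x → x ≤ n → T (suc n) (suc k) (suc x) ≡ T (suc n) (suc k) x ℚ.+ -q ℚ.* T n k x
  T-step n k x x≤n =
    trans (cong toℚ (krawtchouk-step n k x x≤n))
          (trans (toℚ-+ (krawtchouk (suc Q) (suc n) (suc k) x) (-[1+ Q ] * krawtchouk (suc Q) n k x)) (cong (ℚ._+_ (T (suc n) (suc k) x)) (toℚ-* -[1+ Q ] (krawtchouk (suc Q) n k x))))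

  -- Since K_0 = 1, stepping x changes an expansion by the shifted expansion.
  expansion-step : ∀ n (d : Fin (suc (suc n)) → ℚ) x → x ≤ n →
    expansion (suc n) d (suc x) ≡ expansion (suc n) d x ℚ.+ expansion n (shift d) x
  expansion-step n d x x≤n = begin
    d₀ ℚ.+ sumℚ (suc n) (λ k → d (Fin.suc k) ℚ.* T (suc n) (suc (toℕ k)) (suc x))
      ≡⟨ cong (ℚ._+_ d₀) (sumℚ-cong (suc n) split) ⟩
    d₀ ℚ.+ sumℚ (suc n) (λ k → higher k ℚ.+ lowered k)
      ≡⟨ cong (ℚ._+_ d₀) (sumℚ-distrib-+ (suc n) higher lowered) ⟩
    d₀ ℚ.+ (sumℚ (suc n) higher ℚ.+ expansion n (shift d) x)
      ≡⟨ sym (ℚP.+-assoc d₀ (sumℚ (suc n) higher) (expansion n (shift d) x)) ⟩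
    expansion (suc n) d x ℚ.+ expansion n (shift d) x ∎
    where
    open ≡-Reasoning
    d₀ = d Fin.zero ℚ.* 1ℚ
    higher lowered : Fin (suc n) → ℚ
    higher k = d (Fin.suc k) ℚ.* T (suc n) (suc (toℕ k)) x
    lowered k = shift d k ℚ.* T n (toℕ k) x
    split : ∀ k → d (Fin.suc k) ℚ.* T (suc n) (suc (toℕ k)) (suc x) ≡ higher k ℚ.+ lowered k
    split k = trans (cong (d (Fin.suc k) ℚ.*_) (T-step n (toℕ k) x x≤n))
                    (solve 4 (λ D A c B → D :* (A :+ c :* B) := D :* A :+ (D :* c) :* B) refl
                           (d (Fin.suc k)) (T (suc n) (suc (toℕ k)) x) -q (T n (toℕ k) x))

  expansion-head : ∀ n (d e : Fin (suc n) → ℚ) → (∀ k → d (Fin.suc k) ≡ e (Fin.suc k)) →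
    expansion n d 0 ≡ expansion n e 0 → d Fin.zero ≡ e Fin.zero
  expansion-head n d e tails≡ values≡ = begin
    d Fin.zero            ≡⟨ sym (ℚP.*-identityʳ (d Fin.zero)) ⟩
    d Fin.zero ℚ.* 1ℚ     ≡⟨ ∙-cancelʳ (tail e) (d Fin.zero ℚ.* 1ℚ) (e Fin.zero ℚ.* 1ℚ)
                               (trans (cong (ℚ._+_ (d Fin.zero ℚ.* 1ℚ)) tails) values≡) ⟩
    e Fin.zero ℚ.* 1ℚ     ≡⟨ ℚP.*-identityʳ (e Fin.zero) ⟩
    e Fin.zero            ∎
    where
    open ≡-Reasoning
    tail : (Fin (suc n) → ℚ) → ℚ
    tail c = sumℚ n (λ k → c (Fin.suc k) ℚ.* T n (suc (toℕ k)) 0)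
    tails : tail e ≡ tail d
    tails = sumℚ-cong n (λ k → cong (ℚ._* T n (suc (toℕ k)) 0) (sym (tails≡ k)))

  expansion-injective : ∀ n (d e : Fin (suc n) → ℚ) →
    (∀ (i : Fin (suc n)) → expansion n d (toℕ i) ≡ expansion n e (toℕ i)) → ∀ k → d k ≡ e k
  expansion-injective zero    d e values≡ Fin.zero = expansion-head zero d e (λ ()) (values≡ Fin.zero)
  expansion-injective (suc n) d e values≡ = coefficients≡
    where
    values≡-at : ∀ x → x ≤ suc n → expansion (suc n) d x ≡ expansion (suc n) e x
    values≡-at x x≤ = subst (λ t → expansion (suc n) d t ≡ expansion (suc n) e t)
                            (FinP.toℕ-fromℕ< (s≤s x≤)) (values≡ (Fin.fromℕ< (s≤s x≤)))
    shifted≡ : ∀ (i : Fin (suc n)) → expansion n (shift d) (toℕ i) ≡ expansion n (shift e) (toℕ i)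
    shifted≡ i = ∙-cancelˡ (expansion (suc n) d x) _ _ (begin
      expansion (suc n) d x ℚ.+ expansion n (shift d) x  ≡⟨ sym (expansion-step n d x x≤n) ⟩
      expansion (suc n) d (suc x)                        ≡⟨ values≡-at (suc x) (s≤s x≤n) ⟩
      expansion (suc n) e (suc x)                        ≡⟨ expansion-step n e x x≤n ⟩
      expansion (suc n) e x ℚ.+ expansion n (shift e) x  ≡⟨ cong (ℚ._+ expansion n (shift e) x) (sym (values≡-at x (ℕP.m≤n⇒m≤1+n x≤n))) ⟩
      expansion (suc n) d x ℚ.+ expansion n (shift e) x  ∎)
      where
      open ≡-Reasoning
      x = toℕ i
      x≤n : x ≤ n
      x≤n = ℕP.≤-pred (FinP.toℕ<n i)
    tails≡ : ∀ k → d (Fin.suc k) ≡ e (Fin.suc k)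
    tails≡ k = *-cancelʳ-nonZero (d (Fin.suc k)) (e (Fin.suc k)) -q (expansion-injective n (shift d) (shift e) shifted≡ k)
    coefficients≡ : ∀ k → d k ≡ e k
    coefficients≡ Fin.zero    = expansion-head (suc n) d e tails≡ (values≡ Fin.zero)
    coefficients≡ (Fin.suc k) = tails≡ k

module FallingFactorialExpansion (Q n j r : ℕ) (j+r≡n : j ℕ.+ r ≡ n) where
  open Krawtchouk Q using (q; integralExpansion)
  open Expansions Q using (T; expansion)

  h : Fin (suc n) → ℚ
  h x = toℚ (hfun n j (toℕ x))

  qʲ : ℚ
  qʲ = toℚ (+ (suc Q ℕ.^ j))

  instance
    qʲ>0 : ℚ.Positive qʲ
    qʲ>0 = ℚP.normalize-pos (suc Q ℕ.^ j) 1 {{_}} {{ℕP.m^n≢0 (suc Q) j}}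
    qʲ≢0 : ℚ.NonZero qʲ
    qʲ≢0 = ℚP.pos⇒nonZero qʲ

  numerator : ℕ → ℤ
  numerator k = + (j ! ℕ.* coeff r j k)

  coefficient : Fin (suc n) → ℚ
  coefficient k = toℚ (numerator (toℕ k)) ℚ.* ℚ.1/ qʲ

  represents : Represents (suc Q) n h coefficient
  represents i = begin
    toℚ (hfun n j x)
      ≡⟨ sym (1/p-cancels qʲ (toℚ (hfun n j x))) ⟩
    ℚ.1/ qʲ ℚ.* (qʲ ℚ.* toℚ (hfun n j x))
      ≡⟨ cong (ℚ.1/ qʲ ℚ.*_) (sym (toℚ-* (+ (suc Q ℕ.^ j)) (hfun n j x))) ⟩
    ℚ.1/ qʲ ℚ.* toℚ (+ (suc Q ℕ.^ j) * hfun n j x)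
      ≡⟨ cong (λ t → ℚ.1/ qʲ ℚ.* toℚ (t * hfun n j x)) (sym (pos-^ (suc Q) j)) ⟩
    ℚ.1/ qʲ ℚ.* toℚ (q ℤ.^ j * hfun n j x)
      ≡⟨ cong (λ t → ℚ.1/ qʲ ℚ.* toℚ t) (integralExpansion n j r x j+r≡n x≤n) ⟩
    ℚ.1/ qʲ ℚ.* toℚ (sumℤ (suc n) (λ k → numerator (toℕ k) * krawtchouk (suc Q) n (toℕ k) x))
      ≡⟨ cong (ℚ.1/ qʲ ℚ.*_) (sym (sumℚ-toℚ (suc n) (λ k → numerator (toℕ k) * krawtchouk (suc Q) n (toℕ k) x))) ⟩
    ℚ.1/ qʲ ℚ.* sumℚ (suc n) (λ k → toℚ (numerator (toℕ k) * krawtchouk (suc Q) n (toℕ k) x))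
      ≡⟨ sym (sumℚ-scalar (suc n) (ℚ.1/ qʲ) (λ k → toℚ (numerator (toℕ k) * krawtchouk (suc Q) n (toℕ k) x))) ⟩
    sumℚ (suc n) (λ k → ℚ.1/ qʲ ℚ.* toℚ (numerator (toℕ k) * krawtchouk (suc Q) n (toℕ k) x))
      ≡⟨ sumℚ-cong (suc n) term ⟩
    expansion n coefficient x ∎
    where
    open ≡-Reasoning
    x = toℕ i
    x≤n : x ≤ n
    x≤n = ℕP.≤-pred (FinP.toℕ<n i)
    term : ∀ k → ℚ.1/ qʲ ℚ.* toℚ (numerator (toℕ k) * krawtchouk (suc Q) n (toℕ k) x) ≡ coefficient k ℚ.* T n (toℕ k) x
    term k = trans (cong (ℚ.1/ qʲ ℚ.*_) (toℚ-* (numerator (toℕ k)) (krawtchouk (suc Q) n (toℕ k) x)))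
                   (solve 3 (λ w a t → w :* (a :* t) := (a :* w) :* t) refl (ℚ.1/ qʲ) (toℚ (numerator (toℕ k))) (T n (toℕ k) x))

  nonnegative : (k : Fin (suc n)) → 0ℚ ℚ.≤ coefficient k
  nonnegative k = ℚP.nonNegative⁻¹ (coefficient k)
    {{ℚP.nonNeg*nonNeg⇒nonNeg (toℚ (numerator (toℕ k))) {{ℚP.normalize-nonNeg (j ! ℕ.* coeff r j (toℕ k)) 1}}
                              (ℚ.1/ qʲ) {{ℚP.pos⇒nonNeg (ℚ.1/ qʲ) {{ℚP.1/pos⇒pos qʲ}}}}}}

fallingFactorial-positiveDefinite : ∀ Q n j → j ≤ n → PositiveDefinite (suc Q) n (λ x → toℚ (hfun n j (toℕ x)))
fallingFactorial-positiveDefinite Q n j j≤n = coefficient , represents , unique , nonnegative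
  where
  open FallingFactorialExpansion Q n j (n ∸ j) (ℕP.m+[n∸m]≡n j≤n)
  open Expansions Q using (expansion-injective)
  unique : (c′ : Fin (suc n) → ℚ) → Represents (suc Q) n h c′ → (k : Fin (suc n)) → c′ k ≡ coefficient k
  unique c′ represents′ = expansion-injective n c′ coefficient (λ i → trans (sym (represents′ i)) (represents i))

lemma4p6 : (q n j : ℕ) → 2 ≤ q → 1 ≤ n → j ≤ n →
    PositiveDefinite q n (λ x → toℚ (hfun n j (toℕ x)))
lemma4p6 zero    n j ()  _ _
lemma4p6 (suc Q) n j _ _ j≤n = fallingFactorial-positiveDefinite Q n j j≤n
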